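{- Let $\Sigma$ be a finite $d$-dimensional CW complex with $r=\operatorname{rank}\partial_d$. A set of $r$ rows of $\partial_d$ forms a basis of the row space of $\partial_d$ if and only if the corresponding set of $(d-1)$-cells is the complement in $\Sigma_{d-1}$ of the set of $(d-1)$-cells of a relatively acyclic $(d-1)$-subcomplex of $\Sigma$.
   Context: $\Sigma$ has the convention of a unique $(-1)$-cell (reduced homology); $\Sigma_i$ is the set of $i$-cells, $\Sigma_{(i)}$ the $i$-skeleton; cells are oriented and $\partial_d$ is the matrix of the top cellular boundary map (rows indexed by $(d-1)$-cells). A subcomplex $\Gamma$ of dimension $\le d-1$ with $\Gamma_{(d-2)}=\Sigma_{(d-2)}$ is relatively acyclic if inclusion induces isomorphisms $\tilde H_k(\Gamma;\mathbb{Q})\to\tilde H_k(\Sigma;\mathbb{Q})$ for all $k<d$. -}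

module Defs where

open import Data.Nat as ℕ using (ℕ; zero; suc; _<_; _≤_)
open import Data.Integer as ℤ using (ℤ)
open import Data.Rational as ℚ using (ℚ; 0ℚ)
open import Data.Fin using (Fin; zero; suc)
open import Data.Fin.Subset using (Subset; _∈_; _∉_)
open import Data.Product using (Σ; ∃; _×_)
open import Data.Unit using (⊤)
open import Relation.Binary.PropositionalEquality using (_≡_)

sumℤ : ∀ {n} → (Fin n → ℤ) → ℤ
sumℤ {zero}  f = ℤ.+ 0
sumℤ {suc n} f = f zero ℤ.+ sumℤ (λ i → f (suc i))

sumℚ : ∀ {n} → (Fin n → ℚ) → ℚ
sumℚ {zero}  f = 0ℚ
sumℚ {suc n} f = f zero ℚ.+ sumℚ (λ i → f (suc i))

toℚ : ℤ → ℚ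
toℚ z = z ℚ./ 1

-- A finite d-dimensional CW complex, recorded through its reduced
-- cellular chain complex.  Cells are indexed by LEVEL: level i holds
-- the cells of dimension i - 1, so level 0 holds the unique (-1)-cell
-- and level d+1 holds the d-cells.  bd k is the matrix of the cellular
-- boundary map ∂_k (from k-cells = level k+1 to (k-1)-cells = level k);
-- rows are indexed by the (k-1)-cells, columns by the k-cells, and the
-- entry (σ , τ) is the incidence number [τ : σ].

record CWComplex (d : ℕ) : Set where
  field
    size      : ℕ → ℕ
    unique-₋₁ : size 0 ≡ 1
    finiteDim : ∀ i → suc d < i → size i ≡ 0
    hasTop    : 1 ≤ size (suc d)
    bd        : (k : ℕ) → Fin (size k) → Fin (size (suc k)) → ℤ
    augment   : ∀ σ τ → bd 0 σ τ ≡ ℤ.+ 1     -- reduced augmentation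
    bd∘bd     : ∀ k σ ρ →
                sumℤ (λ τ → bd k σ τ ℤ.* bd (suc k) τ ρ) ≡ ℤ.+ 0

open CWComplex public

Vecℚ : ℕ → Set
Vecℚ m = Fin m → ℚ

lincomb : ∀ {k m} → (Fin k → ℚ) → (Fin k → Vecℚ m) → Vecℚ m
lincomb c v j = sumℚ (λ i → c i ℚ.* v i j)

SupportedOn : ∀ {k} → Subset k → (Fin k → ℚ) → Set
SupportedOn S c = ∀ i → i ∉ S → c i ≡ 0ℚ

InSpanOf : ∀ {k m} → (Fin k → Vecℚ m) → Subset k → Vecℚ m → Set
InSpanOf v S w = Σ (Fin _ → ℚ) λ c → SupportedOn S c × (∀ j → lincomb c v j ≡ w j)

InSpan : ∀ {k m} → (Fin k → Vecℚ m) → Vecℚ m → Set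
InSpan v w = Σ (Fin _ → ℚ) λ c → ∀ j → lincomb c v j ≡ w j

LinIndepOn : ∀ {k m} → (Fin k → Vecℚ m) → Subset k → Set
LinIndepOn v S = ∀ c → SupportedOn S c → (∀ j → lincomb c v j ≡ 0ℚ) →
                 ∀ i → i ∈ S → c i ≡ 0ℚ

LinIndep : ∀ {k m} → (Fin k → Vecℚ m) → Set
LinIndep v = ∀ c → (∀ j → lincomb c v j ≡ 0ℚ) → ∀ i → c i ≡ 0ℚ

Matℤ : ℕ → ℕ → Set
Matℤ p m = Fin p → Fin m → ℤ

rowsℚ : ∀ {p m} → Matℤ p m → Fin p → Vecℚ m
rowsℚ M i j = toℚ (M i j)

IsBasisOfRowSpace : ∀ {k p m} → (Fin k → Vecℚ m) → Matℤ p m → Set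
IsBasisOfRowSpace b M =
  LinIndep b ×
  (∀ w → (InSpan b w → InSpan (rowsℚ M) w) × (InSpan (rowsℚ M) w → InSpan b w))

HasRank : ∀ {p m} → Matℤ p m → ℕ → Set
HasRank {m = m} M r = Σ (Fin r → Vecℚ m) λ b → IsBasisOfRowSpace b M

RowsFormBasis : ∀ {p m} → Matℤ p m → Subset p → Set
RowsFormBasis M S =
  LinIndepOn (rowsℚ M) S ×
  (∀ i → InSpanOf (rowsℚ M) S (rowsℚ M i))

module _ {d : ℕ} (X : CWComplex d) where

  Chain : ℕ → Set
  Chain i = Vecℚ (size X i)

  bdℚ : (k : ℕ) → Chain (suc k) → Chain k
  bdℚ k x σ = sumℚ (λ τ → toℚ (bd X k σ τ) ℚ.* x τ)

  IsCycle : (i : ℕ) → Chain i → Set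
  IsCycle zero    x = ⊤
  IsCycle (suc k) x = ∀ σ → bdℚ k x σ ≡ 0ℚ

  -- Chains of the subcomplex Γ = Σ_(d-2) ∪ (the (d-1)-cells in G):
  -- unrestricted below level d (= dimension d-1), supported on G at
  -- level d, and zero above level d.
  InΓ : Subset (size X d) → (i : ℕ) → Chain i → Set
  InΓ G i x with ℕ.compare i d
  ... | ℕ.less _ _    = ⊤
  ... | ℕ.equal _     = ∀ σ → σ ∉ G → x σ ≡ 0ℚ
  ... | ℕ.greater _ _ = ∀ σ → x σ ≡ 0ℚ

  IsBoundaryΣ : (i : ℕ) → Chain i → Set
  IsBoundaryΣ i x = Σ (Chain (suc i)) λ y → ∀ σ → bdℚ i y σ ≡ x σ

  IsBoundaryΓ : Subset (size X d) → (i : ℕ) → Chain i → Set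
  IsBoundaryΓ G i x =
    Σ (Chain (suc i)) λ y → InΓ G (suc i) y × (∀ σ → bdℚ i y σ ≡ x σ)

  -- The map H̃_k(Γ;ℚ) → H̃_k(Σ;ℚ) induced by inclusion (level i = k+1),
  -- [z] ↦ [z], is injective.
  InducedInjective : Subset (size X d) → ℕ → Set
  InducedInjective G i =
    ∀ (z : Chain i) → InΓ G i z → IsCycle i z →
      IsBoundaryΣ i z → IsBoundaryΓ G i z

  -- ... and surjective.
  InducedSurjective : Subset (size X d) → ℕ → Set
  InducedSurjective G i =
    ∀ (z : Chain i) → IsCycle i z →
      Σ (Chain i) λ z' → InΓ G i z' × IsCycle i z' ×
        IsBoundaryΣ i (λ σ → z σ ℚ.- z' σ)

  -- Γ is relatively acyclic: inclusion induces isomorphisms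
  -- H̃_k(Γ;ℚ) ≅ H̃_k(Σ;ℚ) for all -1 ≤ k < d, i.e. levels i = k+1 ≤ d.
  RelativelyAcyclic : Subset (size X d) → Set
  RelativelyAcyclic G =
    ∀ i → i ≤ d → InducedInjective G i × InducedSurjective G i

-- Let Γ be the subcomplex whose (d-1)-cells are those outside S, and R the rows of ∂_d.
-- Γ agrees with Σ below dimension d-1 and has no d-cells, so only H̃_{d-1} and H̃_{d-2}
-- can change. The rows in S span the row space iff a boundary ∂y vanishing on S vanishes
-- everywhere, i.e. iff a (d-1)-cycle of Γ bounding in Σ is zero: injectivity on H̃_{d-1}.
-- The rows in S are independent iff ∂y can take arbitrary prescribed values on S, i.e.
-- iff every (d-1)-chain is a chain of Γ modulo boundaries; this gives surjectivity on
-- H̃_{d-1} and injectivity on H̃_{d-2}. Conversely a relation c among the rows in S kills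
-- every cycle, and by acyclicity every chain is a cycle modulo Γ, on which c vanishes.
-- Passing between rows and chains is the duality "span = double annihilator" over ℚ,
-- proved by Gaussian elimination.
module Submission where

open import Algebra.Bundles using (CommutativeRing)
import Algebra.Lattice.Properties.BooleanAlgebra as BooleanAlgebra
open import Data.Empty using (⊥-elim)
open import Data.Fin as Fin using (Fin; zero; suc)
open import Data.Fin.Properties using (any?; suc-injective)
open import Data.Fin.Subset using (Subset; ∣_∣; _∈_; _∉_; ∁)
open import Data.Fin.Subset.Properties
  using (_∈?_; x∈p⇒x∉∁p; x∉∁p⇒x∈p; x∉p⇒x∈∁p; x∈∁p⇒x∉p; ∪-∩-booleanAlgebra)
open import Data.Integer as ℤ using (ℤ)
import Data.Integer.Properties as ℤP
open import Data.Nat as ℕ using (ℕ; zero; suc; _<_)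
import Data.Nat.Properties as ℕP
open import Data.Product using (Σ; ∃; _×_; _,_; proj₁; proj₂)
open import Data.Rational using (ℚ; 0ℚ; 1ℚ; _+_; _*_; _-_; -_; 1/_; NonZero; ≢-nonZero; toℚᵘ)
import Data.Rational.Properties as ℚP
open import Data.Rational.Solver using (module +-*-Solver)
import Data.Rational.Unnormalised.Base as ℚᵘ
import Data.Rational.Unnormalised.Properties as ℚᵘ
open import Data.Sum using (inj₁; inj₂)
open import Data.Unit using (tt)
open import Data.Vec.Functional using (_∷_)
open import Function.Base using (_∘_; id)
open import Function.Bundles using (_⇔_; mk⇔; module Equivalence)
open import Relation.Binary.PropositionalEquality
open import Relation.Nullary using (yes; no; ¬?)
open import Relation.Nullary.Decidable using (decidable-stable)

open import Defs
open import Algebra.Properties.Semiring.Sum (CommutativeRing.semiring ℚP.+-*-commutativeRing)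
  using (sum; sum-cong-≗; sum-replicate-zero; ∑-distrib-+; ∑-comm; *-distribˡ-sum; *-distribʳ-sum)
open Equivalence using (to; from)
open ≡-Reasoning
open +-*-Solver

sumℚ≡sum : ∀ {n} (f : Fin n → ℚ) → sumℚ f ≡ sum f
sumℚ≡sum {zero}  f = refl
sumℚ≡sum {suc n} f = cong (f zero +_) (sumℚ≡sum (f ∘ suc))

sumℚ-cong : ∀ {n} {f g : Fin n → ℚ} → (∀ i → f i ≡ g i) → sumℚ f ≡ sumℚ g
sumℚ-cong {f = f} {g} f≗g = trans (sumℚ≡sum f) (trans (sum-cong-≗ f≗g) (sym (sumℚ≡sum g)))

sumℚ-zero : ∀ {n} {f : Fin n → ℚ} → (∀ i → f i ≡ 0ℚ) → sumℚ f ≡ 0ℚ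
sumℚ-zero {n} f≗0 = trans (sumℚ-cong f≗0) (trans (sumℚ≡sum {n} (λ _ → 0ℚ)) (sum-replicate-zero n))

*-distribˡ-sumℚ : ∀ {n} a (f : Fin n → ℚ) → a * sumℚ f ≡ sumℚ (λ i → a * f i)
*-distribˡ-sumℚ a f =
  trans (cong (a *_) (sumℚ≡sum f)) (trans (*-distribˡ-sum a f) (sym (sumℚ≡sum (λ i → a * f i))))

*-distribʳ-sumℚ : ∀ {n} a (f : Fin n → ℚ) → sumℚ f * a ≡ sumℚ (λ i → f i * a)
*-distribʳ-sumℚ a f =
  trans (cong (_* a) (sumℚ≡sum f)) (trans (*-distribʳ-sum a f) (sym (sumℚ≡sum (λ i → f i * a))))

sumℚ-linear : ∀ {n} (f g : Fin n → ℚ) t →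
              sumℚ (λ i → f i - t * g i) ≡ sumℚ f - t * sumℚ g
sumℚ-linear f g t = begin
  sumℚ (λ i → f i - t * g i)             ≡⟨ sumℚ-cong (λ i → cong (f i +_) (ℚP.neg-distribˡ-* t (g i))) ⟩
  sumℚ (λ i → f i + - t * g i)           ≡⟨ sumℚ≡sum (λ i → f i + - t * g i) ⟩
  sum (λ i → f i + - t * g i)            ≡⟨ ∑-distrib-+ f (λ i → - t * g i) ⟩
  sum f + sum (λ i → - t * g i)          ≡⟨ cong₂ _+_ (sumℚ≡sum f) (sumℚ≡sum (λ i → - t * g i)) ⟨
  sumℚ f + sumℚ (λ i → - t * g i)        ≡⟨ cong (sumℚ f +_) (*-distribˡ-sumℚ (- t) g) ⟨
  sumℚ f + - t * sumℚ g                  ≡⟨ cong (sumℚ f +_) (ℚP.neg-distribˡ-* t (sumℚ g)) ⟨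
  sumℚ f - t * sumℚ g                    ∎

sumℚ-comm : ∀ {n m} (f : Fin n → Fin m → ℚ) →
            sumℚ (λ i → sumℚ (f i)) ≡ sumℚ (λ j → sumℚ (λ i → f i j))
sumℚ-comm f = begin
  sumℚ (λ i → sumℚ (f i))           ≡⟨ sumℚ-cong (λ i → sumℚ≡sum (f i)) ⟩
  sumℚ (λ i → sum (f i))            ≡⟨ sumℚ≡sum (λ i → sum (f i)) ⟩
  sum (λ i → sum (f i))             ≡⟨ ∑-comm f ⟩
  sum (λ j → sum (λ i → f i j))     ≡⟨ sumℚ≡sum (λ j → sum (λ i → f i j)) ⟨
  sumℚ (λ j → sum (λ i → f i j))    ≡⟨ sumℚ-cong (λ j → sumℚ≡sum (λ i → f i j)) ⟨
  sumℚ (λ j → sumℚ (λ i → f i j))   ∎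

sumℚ-single : ∀ {n} (f : Fin n → ℚ) j → (∀ i → i ≢ j → f i ≡ 0ℚ) → sumℚ f ≡ f j
sumℚ-single f zero    f≗0 = trans (cong (f zero +_) (sumℚ-zero (λ i → f≗0 (suc i) λ ()))) (ℚP.+-identityʳ _)
sumℚ-single f (suc j) f≗0 = trans (cong (_+ sumℚ (f ∘ suc)) (f≗0 zero λ ()))
  (trans (ℚP.+-identityˡ _) (sumℚ-single (f ∘ suc) j (λ i i≢j → f≗0 (suc i) (i≢j ∘ suc-injective))))

infix  7 _·_
infixl 6 _-ᵛ_
infixr 7 _*ᵛ_

_·_ : ∀ {m} → Vecℚ m → Vecℚ m → ℚ
x · y = sumℚ (λ j → x j * y j)

_-ᵛ_ : ∀ {m} → Vecℚ m → Vecℚ m → Vecℚ m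
(x -ᵛ y) j = x j - y j

_*ᵛ_ : ∀ {m} → ℚ → Vecℚ m → Vecℚ m
(t *ᵛ x) j = t * x j

unit : ∀ {m} → Fin m → Vecℚ m
unit j i with i Fin.≟ j
... | yes _ = 1ℚ
... | no  _ = 0ℚ

·-comm : ∀ {m} (x y : Vecℚ m) → x · y ≡ y · x
·-comm x y = sumℚ-cong (λ j → ℚP.*-comm (x j) (y j))

·-linearʳ : ∀ {m} (x y z : Vecℚ m) t → x · (y -ᵛ t *ᵛ z) ≡ x · y - t * (x · z)
·-linearʳ x y z t = trans
  (sumℚ-cong (λ j → solve 4 (λ a b c s → a :* (b :- s :* c) := a :* b :- s :* (a :* c)) refl (x j) (y j) (z j) t))
  (sumℚ-linear (λ j → x j * y j) (λ j → x j * z j) t)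

·-linearˡ : ∀ {m} (x y z : Vecℚ m) t → (x -ᵛ t *ᵛ y) · z ≡ x · z - t * (y · z)
·-linearˡ x y z t = trans (·-comm _ z)
  (trans (·-linearʳ z x y t) (cong₂ (λ a b → a - t * b) (·-comm z x) (·-comm z y)))

·-distribʳ-sub : ∀ {m} (x y z : Vecℚ m) → x · (y -ᵛ z) ≡ x · y - x · z
·-distribʳ-sub x y z = begin
  x · (y -ᵛ z)
    ≡⟨ sumℚ-cong (λ j → solve 3 (λ a b c → a :* (b :- c) := a :* b :- con 1ℚ :* (a :* c))
                                refl (x j) (y j) (z j)) ⟩
  sumℚ (λ j → x j * y j - 1ℚ * (x j * z j))
    ≡⟨ sumℚ-linear (λ j → x j * y j) (λ j → x j * z j) 1ℚ ⟩
  x · y - 1ℚ * (x · z)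
    ≡⟨ cong (_-_ (x · y)) (ℚP.*-identityˡ (x · z)) ⟩
  x · y - x · z
    ∎

·-≡0-split : ∀ {m} (x y z : Vecℚ m) → x · (y -ᵛ z) ≡ 0ℚ → x · z ≡ 0ℚ → x · y ≡ 0ℚ
·-≡0-split x y z x·[y-z]≡0 x·z≡0 = begin
  x · y                          ≡⟨ solve 2 (λ a b → a := (a :- b) :+ b) refl (x · y) (x · z) ⟩
  (x · y - x · z) + x · z        ≡⟨ cong₂ _+_ (trans (sym (·-distribʳ-sub x y z)) x·[y-z]≡0) x·z≡0 ⟩
  0ℚ + 0ℚ                        ≡⟨ ℚP.+-identityʳ 0ℚ ⟩
  0ℚ                             ∎

·-unitʳ : ∀ {m} (x : Vecℚ m) j → x · unit j ≡ x j
·-unitʳ x j = trans (sumℚ-single _ j off-j) on-j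
  where
  on-j : x j * unit j j ≡ x j
  on-j with j Fin.≟ j
  ... | yes _   = ℚP.*-identityʳ (x j)
  ... | no  j≢j = ⊥-elim (j≢j refl)
  off-j : ∀ i → i ≢ j → x i * unit j i ≡ 0ℚ
  off-j i i≢j with i Fin.≟ j
  ... | yes i≡j = ⊥-elim (i≢j i≡j)
  ... | no  _   = ℚP.*-zeroʳ (x i)

·-zeroʳ : ∀ {m} (x y : Vecℚ m) → (∀ j → y j ≡ 0ℚ) → x · y ≡ 0ℚ
·-zeroʳ x y y≗0 = sumℚ-zero (λ j → trans (cong (x j *_) (y≗0 j)) (ℚP.*-zeroʳ (x j)))

·-zeroˡ : ∀ {m} (x y : Vecℚ m) → (∀ j → x j ≡ 0ℚ) → x · y ≡ 0ℚ
·-zeroˡ x y x≗0 = trans (·-comm x y) (·-zeroʳ y x x≗0)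

·-disjoint : ∀ {m} (S : Subset m) (x y : Vecℚ m) →
             (∀ j → j ∉ S → x j ≡ 0ℚ) → (∀ j → j ∈ S → y j ≡ 0ℚ) → x · y ≡ 0ℚ
·-disjoint S x y x∉S≡0 y∈S≡0 = sumℚ-zero xy≡0
  where
  xy≡0 : ∀ j → x j * y j ≡ 0ℚ
  xy≡0 j with j ∈? S
  ... | yes j∈S = trans (cong (x j *_) (y∈S≡0 j j∈S)) (ℚP.*-zeroʳ (x j))
  ... | no  j∉S = trans (cong (_* y j) (x∉S≡0 j j∉S)) (ℚP.*-zeroˡ (y j))

·-lincomb : ∀ {k m} (c : Fin k → ℚ) (v : Fin k → Vecℚ m) (y : Vecℚ m) →
            c · (λ i → v i · y) ≡ lincomb c v · y
·-lincomb c v y = begin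
  c · (λ i → v i · y)
    ≡⟨ sumℚ-cong (λ i → *-distribˡ-sumℚ (c i) (λ j → v i j * y j)) ⟩
  sumℚ (λ i → sumℚ (λ j → c i * (v i j * y j)))
    ≡⟨ sumℚ-comm (λ i j → c i * (v i j * y j)) ⟩
  sumℚ (λ j → sumℚ (λ i → c i * (v i j * y j)))
    ≡⟨ sumℚ-cong (λ j → sumℚ-cong (λ i → ℚP.*-assoc (c i) (v i j) (y j))) ⟨
  sumℚ (λ j → sumℚ (λ i → c i * v i j * y j))
    ≡⟨ sumℚ-cong (λ j → *-distribʳ-sumℚ (y j) (λ i → c i * v i j)) ⟨
  lincomb c v · y
    ∎

Annihilates : ∀ {k m} → Vecℚ m → (Fin k → Vecℚ m) → Set
Annihilates y v = ∀ i → v i · y ≡ 0ℚ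

-- Elimination at a pivot v₀ⱼ ≠ 0 (v₀ = v zero): reduce clears column j, and shift moves y
-- into the annihilator of v₀ without changing its pairing with reduced vectors.
module Pivot {k m} (v : Fin (suc k) → Vecℚ m) (j : Fin m) (v₀ⱼ≢0 : v zero j ≢ 0ℚ) where

  private
    v₀ : Vecℚ m
    v₀ = v zero

    instance
      v₀ⱼ-nonZero : NonZero (v₀ j)
      v₀ⱼ-nonZero = ≢-nonZero v₀ⱼ≢0

  α : Vecℚ m → ℚ
  α u = u j * 1/ (v₀ j)

  reduce : Vecℚ m → Vecℚ m
  reduce u = u -ᵛ α u *ᵛ v₀

  shift : Vecℚ m → Vecℚ m
  shift y = y -ᵛ ((v₀ · y) * 1/ (v₀ j)) *ᵛ unit j

  ·-shift : ∀ u y → u · shift y ≡ reduce u · y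
  ·-shift u y = begin
    u · shift y                       ≡⟨ ·-linearʳ u y (unit j) t ⟩
    u · y - t * (u · unit j)          ≡⟨ cong (λ q → u · y - t * q) (·-unitʳ u j) ⟩
    u · y - t * u j                   ≡⟨ cong (_-_ (u · y)) t*uⱼ≡αu*v₀·y ⟩
    u · y - α u * (v₀ · y)            ≡⟨ ·-linearˡ u v₀ y (α u) ⟨
    reduce u · y                      ∎
    where
    t = (v₀ · y) * 1/ (v₀ j)
    t*uⱼ≡αu*v₀·y : t * u j ≡ α u * (v₀ · y)
    t*uⱼ≡αu*v₀·y = solve 3 (λ a b p → a :* p :* b := b :* p :* a) refl (v₀ · y) (u j) (1/ (v₀ j))

  reduce-pivot : ∀ l → reduce v₀ l ≡ 0ℚ
  reduce-pivot l = begin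
    v₀ l - α v₀ * v₀ l     ≡⟨ cong (λ a → v₀ l - a * v₀ l) (ℚP.*-inverseʳ (v₀ j)) ⟩
    v₀ l - 1ℚ * v₀ l       ≡⟨ cong (_-_ (v₀ l)) (ℚP.*-identityˡ (v₀ l)) ⟩
    v₀ l - v₀ l            ≡⟨ ℚP.+-inverseʳ (v₀ l) ⟩
    0ℚ                     ∎

  shift-annihilates : ∀ y → Annihilates y (reduce ∘ v ∘ suc) → Annihilates (shift y) v
  shift-annihilates y y⊥ zero    = trans (·-shift v₀ y) (·-zeroˡ (reduce v₀) y reduce-pivot)
  shift-annihilates y y⊥ (suc i) = trans (·-shift (v (suc i)) y) (y⊥ i)

  lift-span : ∀ w → InSpan (reduce ∘ v ∘ suc) (reduce w) → InSpan v w
  lift-span w (c , c-spans) = (α w - C) ∷ c , spans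
    where
    C = c · (α ∘ v ∘ suc)
    lincomb-reduce : ∀ l → lincomb c (reduce ∘ v ∘ suc) l ≡ lincomb c (v ∘ suc) l - v₀ l * C
    lincomb-reduce l =
      trans (sumℚ-cong (λ i → cong (λ q → c i * (v (suc i) l - q)) (ℚP.*-comm (α (v (suc i))) (v₀ l))))
            (·-linearʳ c (λ i → v (suc i) l) (α ∘ v ∘ suc) (v₀ l))
    spans : ∀ l → lincomb ((α w - C) ∷ c) v l ≡ w l
    spans l = begin
      (α w - C) * v₀ l + L
        ≡⟨ cong ((α w - C) * v₀ l +_) (solve 2 (λ a b → a := (a :- b) :+ b) refl L (v₀ l * C)) ⟩
      (α w - C) * v₀ l + ((L - v₀ l * C) + v₀ l * C)
        ≡⟨ cong (λ q → (α w - C) * v₀ l + (q + v₀ l * C)) (trans (sym (lincomb-reduce l)) (c-spans l)) ⟩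
      (α w - C) * v₀ l + ((w l - α w * v₀ l) + v₀ l * C)
        ≡⟨ solve 4 (λ a b p x → (a :- b) :* p :+ ((x :- a :* p) :+ p :* b) := x) refl (α w) C (v₀ l) (w l) ⟩
      w l
        ∎
      where L = lincomb c (v ∘ suc) l

InSpan-zero∷ : ∀ {k m} (v : Fin (suc k) → Vecℚ m) w → (∀ l → v zero l ≡ 0ℚ) →
               InSpan (v ∘ suc) w → InSpan v w
InSpan-zero∷ v w v₀≡0 (c , c-spans) = 0ℚ ∷ c , λ l →
  trans (cong (_+ lincomb c (v ∘ suc) l) (ℚP.*-zeroˡ (v zero l))) (trans (ℚP.+-identityˡ _) (c-spans l))

annihilator-dual⇒InSpan : ∀ k {m} (v : Fin k → Vecℚ m) (w : Vecℚ m) →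
                           (∀ y → Annihilates y v → w · y ≡ 0ℚ) → InSpan v w
annihilator-dual⇒InSpan zero v w w⊥ =
  (λ ()) , λ j → sym (trans (sym (·-unitʳ w j)) (w⊥ (unit j) (λ ())))
annihilator-dual⇒InSpan (suc k) v w w⊥ with any? (λ j → ¬? (v zero j ℚP.≟ 0ℚ))
... | yes (j , v₀ⱼ≢0) = lift-span w (annihilator-dual⇒InSpan k (reduce ∘ v ∘ suc) (reduce w)
        (λ y y⊥ → trans (sym (·-shift w y)) (w⊥ (shift y) (shift-annihilates y y⊥))))
  where open Pivot v j v₀ⱼ≢0
... | no ∄j = InSpan-zero∷ v w v₀≡0 (annihilator-dual⇒InSpan k (v ∘ suc) w
        (λ y y⊥ → w⊥ y λ { zero → ·-zeroˡ (v zero) y v₀≡0 ; (suc i) → y⊥ i }))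
  where
  v₀≡0 : ∀ l → v zero l ≡ 0ℚ
  v₀≡0 l = decidable-stable (v zero l ℚP.≟ 0ℚ) (λ v₀ₗ≢0 → ∄j (l , v₀ₗ≢0))

restrict : ∀ {n} → Subset n → Vecℚ n → Vecℚ n
restrict S x σ with σ ∈? S
... | yes _ = x σ
... | no  _ = 0ℚ

restrict-∈ : ∀ {n} (S : Subset n) x {σ} → σ ∈ S → restrict S x σ ≡ x σ
restrict-∈ S x {σ} σ∈S with σ ∈? S
... | yes _   = refl
... | no  σ∉S = ⊥-elim (σ∉S σ∈S)

restrict-∉ : ∀ {n} (S : Subset n) x {σ} → σ ∉ S → restrict S x σ ≡ 0ℚ
restrict-∉ S x {σ} σ∉S with σ ∈? S
... | yes σ∈S = ⊥-elim (σ∉S σ∈S)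
... | no  _   = refl

restrict-≡0 : ∀ {n} (S : Subset n) x → (∀ σ → σ ∈ S → x σ ≡ 0ℚ) → ∀ σ → restrict S x σ ≡ 0ℚ
restrict-≡0 S x x∈S≡0 σ with σ ∈? S
... | yes σ∈S = x∈S≡0 σ σ∈S
... | no  _   = refl

restrict-swap : ∀ {n} (S : Subset n) x y σ → restrict S x σ * y σ ≡ x σ * restrict S y σ
restrict-swap S x y σ with σ ∈? S
... | yes _ = refl
... | no  _ = trans (ℚP.*-zeroˡ (y σ)) (sym (ℚP.*-zeroʳ (x σ)))

restrictRows : ∀ {n m} → Subset n → (Fin n → Vecℚ m) → Fin n → Vecℚ m
restrictRows S R σ τ = restrict S (λ ρ → R ρ τ) σ

InSpan-restrictRows : ∀ {n m} (R : Fin n → Vecℚ m) S w →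
                      InSpan (restrictRows S R) w → InSpanOf R S w
InSpan-restrictRows R S w (c , c-spans) =
  restrict S c , (λ σ σ∉S → restrict-∉ S c σ∉S) ,
  λ τ → trans (sumℚ-cong (λ σ → restrict-swap S c (λ ρ → R ρ τ) σ)) (c-spans τ)

InSpanOf-annihilates : ∀ {n m} (R : Fin n → Vecℚ m) S {w} y → InSpanOf R S w →
                       (∀ σ → σ ∈ S → R σ · y ≡ 0ℚ) → w · y ≡ 0ℚ
InSpanOf-annihilates R S {w} y (c , c∈S , c-spans) S⊥y = begin
  w · y                  ≡⟨ sumℚ-cong (λ j → cong (_* y j) (c-spans j)) ⟨
  lincomb c R · y        ≡⟨ ·-lincomb c R y ⟨
  c · (λ σ → R σ · y)    ≡⟨ ·-disjoint S c (λ σ → R σ · y) c∈S S⊥y ⟩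
  0ℚ                     ∎

LinIndepOn⇒solvable : ∀ {n m} (R : Fin n → Vecℚ m) S → LinIndepOn R S →
                      (t : Vecℚ n) → ∃ λ y → ∀ σ → σ ∈ S → R σ · y ≡ t σ
LinIndepOn⇒solvable {n} {m} R S indep t = y , solves
  where
  columns : Fin m → Vecℚ n
  columns τ σ = restrictRows S R σ τ
  restrict-vanishes : ∀ c → Annihilates c columns → ∀ σ → restrict S c σ ≡ 0ℚ
  restrict-vanishes c c⊥ = restrict-≡0 S c λ σ σ∈S →
    trans (sym (restrict-∈ S c σ∈S)) (indep (restrict S c) (λ ρ → restrict-∉ S c) relation σ σ∈S)
    where
    relation : ∀ τ → lincomb (restrict S c) R τ ≡ 0ℚ
    relation τ = trans (sumℚ-cong λ ρ → trans (restrict-swap S c (λ ρ → R ρ τ) ρ) (ℚP.*-comm (c ρ) _)) (c⊥ τ)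
  solution = annihilator-dual⇒InSpan m columns (restrict S t) λ c c⊥ →
    trans (sumℚ-cong (restrict-swap S t c)) (·-zeroʳ t (restrict S c) (restrict-vanishes c c⊥))
  y = proj₁ solution
  solves : ∀ σ → σ ∈ S → R σ · y ≡ t σ
  solves σ σ∈S = begin
    R σ · y                ≡⟨ ·-comm (R σ) y ⟩
    y · R σ                ≡⟨ sumℚ-cong (λ τ → cong (y τ *_) (restrict-∈ S (λ ρ → R ρ τ) σ∈S)) ⟨
    lincomb y columns σ    ≡⟨ proj₂ solution σ ⟩
    restrict S t σ         ≡⟨ restrict-∈ S t σ∈S ⟩
    t σ                    ∎

toℚᵘ-toℚ : ∀ a → toℚᵘ (toℚ a) ℚᵘ.≃ ℚᵘ.mkℚᵘ a 0
toℚᵘ-toℚ a = ℚP.toℚᵘ-fromℚᵘ (ℚᵘ.mkℚᵘ a 0)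

toℚ-+ : ∀ a b → toℚ (a ℤ.+ b) ≡ toℚ a + toℚ b
toℚ-+ a b = ℚP.toℚᵘ-injective (ℚᵘ.≃-trans (toℚᵘ-toℚ (a ℤ.+ b)) (ℚᵘ.≃-trans
  (ℚᵘ.*≡* (cong₂ (λ p q → (p ℤ.+ q) ℤ.* ℤ.+ 1) (sym (ℤP.*-identityʳ a)) (sym (ℤP.*-identityʳ b))))
  (ℚᵘ.≃-sym (ℚᵘ.≃-trans (ℚP.toℚᵘ-homo-+ (toℚ a) (toℚ b))
                        (ℚᵘ.+-cong (toℚᵘ-toℚ a) (toℚᵘ-toℚ b))))))

toℚ-* : ∀ a b → toℚ (a ℤ.* b) ≡ toℚ a * toℚ b
toℚ-* a b = ℚP.toℚᵘ-injective (ℚᵘ.≃-trans (toℚᵘ-toℚ (a ℤ.* b))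
  (ℚᵘ.≃-sym (ℚᵘ.≃-trans (ℚP.toℚᵘ-homo-* (toℚ a) (toℚ b))
                        (ℚᵘ.*-cong (toℚᵘ-toℚ a) (toℚᵘ-toℚ b)))))

toℚ-sumℤ-* : ∀ {n} (f g : Fin n → ℤ) →
             toℚ (sumℤ (λ i → f i ℤ.* g i)) ≡ sumℚ (λ i → toℚ (f i) * toℚ (g i))
toℚ-sumℤ-* {zero}  f g = refl
toℚ-sumℤ-* {suc n} f g = trans (toℚ-+ (f zero ℤ.* g zero) _)
  (cong₂ _+_ (toℚ-* (f zero) (g zero)) (toℚ-sumℤ-* (f ∘ suc) (g ∘ suc)))

module _ {d} (X : CWComplex d) where

  bdℚ-bdℚ : ∀ k x σ → bdℚ X k (bdℚ X (suc k) x) σ ≡ 0ℚ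
  bdℚ-bdℚ k x σ = trans (·-lincomb (rowsℚ (bd X k) σ) (rowsℚ (bd X (suc k))) x) (·-zeroˡ _ x ∂∂≡0)
    where
    ∂∂≡0 : ∀ ρ → lincomb (rowsℚ (bd X k) σ) (rowsℚ (bd X (suc k))) ρ ≡ 0ℚ
    ∂∂≡0 ρ = trans (sym (toℚ-sumℤ-* (bd X k σ) (λ τ → bd X (suc k) τ ρ))) (cong toℚ (bd∘bd X k σ ρ))

  IsCycle-bdℚ : ∀ k x → IsCycle X k (bdℚ X k x)
  IsCycle-bdℚ zero    x = tt
  IsCycle-bdℚ (suc k) x = bdℚ-bdℚ k x

  IsCycle-sub : ∀ k {x y} → IsCycle X k x → IsCycle X k y → IsCycle X k (x -ᵛ y)
  IsCycle-sub zero    _    _    = tt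
  IsCycle-sub (suc k) {x} {y} ∂x≡0 ∂y≡0 σ = begin
    bdℚ X k (x -ᵛ y) σ                ≡⟨ ·-distribʳ-sub (rowsℚ (bd X k) σ) x y ⟩
    bdℚ X k x σ - bdℚ X k y σ         ≡⟨ cong₂ _-_ (∂x≡0 σ) (∂y≡0 σ) ⟩
    0ℚ - 0ℚ                           ≡⟨ ℚP.+-inverseʳ 0ℚ ⟩
    0ℚ                                ∎

  bdℚ-zero : ∀ k σ → bdℚ X k (λ _ → 0ℚ) σ ≡ 0ℚ
  bdℚ-zero k σ = ·-zeroʳ (rowsℚ (bd X k) σ) (λ _ → 0ℚ) (λ _ → refl)

  module _ (G : Subset (size X d)) where

    InΓ-below : ∀ {i} {x : Chain X i} → i < d → InΓ X G i x
    InΓ-below {i} i<d with ℕ.compare i d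
    ... | ℕ.less _ _    = tt
    ... | ℕ.equal _     = ⊥-elim (ℕP.<-irrefl refl i<d)
    ... | ℕ.greater _ _ = ⊥-elim (ℕP.<-asym i<d (ℕ.s≤s (ℕP.m≤m+n _ _)))

    InΓ-above : ∀ {i} {x : Chain X i} → d < i → InΓ X G i x ⇔ (∀ σ → x σ ≡ 0ℚ)
    InΓ-above {i} d<i with ℕ.compare i d
    ... | ℕ.less _ _    = ⊥-elim (ℕP.<-asym d<i (ℕ.s≤s (ℕP.m≤m+n _ _)))
    ... | ℕ.equal _     = ⊥-elim (ℕP.<-irrefl refl d<i)
    ... | ℕ.greater _ _ = mk⇔ id id

    -- Stated for any i ≡ d because ℕ.compare d d does not reduce for a variable d.
    private
      SupportedOnΓ : ∀ {i} → i ≡ d → Chain X i → Set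
      SupportedOnΓ refl x = ∀ σ → σ ∉ G → x σ ≡ 0ℚ

      InΓ-at : ∀ {i} {x : Chain X i} (i≡d : i ≡ d) → InΓ X G i x ⇔ SupportedOnΓ i≡d x
      InΓ-at {i} i≡d with ℕ.compare i d
      InΓ-at i≡d    | ℕ.less _ _    = ⊥-elim (ℕP.<-irrefl i≡d (ℕ.s≤s (ℕP.m≤m+n _ _)))
      InΓ-at refl   | ℕ.equal _     = mk⇔ id id
      InΓ-at i≡d    | ℕ.greater _ _ = ⊥-elim (ℕP.<-irrefl (sym i≡d) (ℕ.s≤s (ℕP.m≤m+n _ _)))

    InΓ-top : ∀ {x : Chain X d} → InΓ X G d x ⇔ (∀ σ → σ ∉ G → x σ ≡ 0ℚ)
    InΓ-top = InΓ-at refl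

    InducedSurjective-below : ∀ {i} → i < d → InducedSurjective X G i
    InducedSurjective-below {i} i<d z z-cycle =
      z , InΓ-below i<d , z-cycle , (λ _ → 0ℚ) , λ σ → trans (bdℚ-zero i σ) (sym (ℚP.+-inverseʳ (z σ)))

    InducedInjective-below : ∀ {i} → suc i < d → InducedInjective X G i
    InducedInjective-below 1+i<d z _ _ (y , ∂y≡z) = y , InΓ-below 1+i<d , ∂y≡z

module _ {d} (X : CWComplex d) (S : Subset (size X d)) where

  private
    R : Fin (size X d) → Vecℚ (size X (suc d))
    R = rowsℚ (bd X d)

  spans⇒InducedInjective-top : (∀ σ → InSpanOf R S (R σ)) → InducedInjective X (∁ S) d
  spans⇒InducedInjective-top spans z z∈Γ _ (y , ∂y≡z) =
    (λ _ → 0ℚ) , from (InΓ-above X (∁ S) (ℕP.n<1+n d)) (λ _ → refl) ,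
    λ σ → trans (bdℚ-zero X d σ) (sym (z≡0 σ))
    where
    z∈S≡0 : ∀ σ → σ ∈ S → z σ ≡ 0ℚ
    z∈S≡0 σ σ∈S = to (InΓ-top X (∁ S)) z∈Γ σ (x∈p⇒x∉∁p σ∈S)
    z≡0 : ∀ σ → z σ ≡ 0ℚ
    z≡0 σ = trans (sym (∂y≡z σ))
      (InSpanOf-annihilates R S y (spans σ) (λ ρ ρ∈S → trans (∂y≡z ρ) (z∈S≡0 ρ ρ∈S)))

  LinIndepOn⇒InΓ-mod-boundary : LinIndepOn R S → (x : Chain X d) →
                                 ∃ λ y → InΓ X (∁ S) d (x -ᵛ bdℚ X d y)
  LinIndepOn⇒InΓ-mod-boundary indep x = y , from (InΓ-top X (∁ S)) λ σ σ∉∁S →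
    trans (cong (_-_ (x σ)) (∂y≡x σ (x∉∁p⇒x∈p σ∉∁S))) (ℚP.+-inverseʳ (x σ))
    where
    y = proj₁ (LinIndepOn⇒solvable R S indep x)
    ∂y≡x = proj₂ (LinIndepOn⇒solvable R S indep x)

  LinIndepOn⇒InducedSurjective-top : LinIndepOn R S → InducedSurjective X (∁ S) d
  LinIndepOn⇒InducedSurjective-top indep z z-cycle =
    z -ᵛ bdℚ X d y , z-∂y∈Γ , IsCycle-sub X d z-cycle (IsCycle-bdℚ X d y) ,
    y , λ σ → solve 2 (λ a b → b := a :- (a :- b)) refl (z σ) (bdℚ X d y σ)
    where
    y = proj₁ (LinIndepOn⇒InΓ-mod-boundary indep z)
    z-∂y∈Γ = proj₂ (LinIndepOn⇒InΓ-mod-boundary indep z)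

LinIndepOn⇒InducedInjective-pred : ∀ {i} (X : CWComplex (suc i)) S →
  LinIndepOn (rowsℚ (bd X (suc i))) S → InducedInjective X (∁ S) i
LinIndepOn⇒InducedInjective-pred {i} X S indep z _ _ (y₀ , ∂y₀≡z) =
  y₀ -ᵛ bdℚ X (suc i) y , y₀-∂y∈Γ , λ σ → begin
    bdℚ X i (y₀ -ᵛ bdℚ X (suc i) y) σ               ≡⟨ ·-distribʳ-sub (rowsℚ (bd X i) σ) y₀ _ ⟩
    bdℚ X i y₀ σ - bdℚ X i (bdℚ X (suc i) y) σ      ≡⟨ cong₂ _-_ (∂y₀≡z σ) (bdℚ-bdℚ X i y σ) ⟩
    z σ - 0ℚ                                        ≡⟨ ℚP.+-identityʳ (z σ) ⟩
    z σ                                             ∎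
  where
  y = proj₁ (LinIndepOn⇒InΓ-mod-boundary X S indep y₀)
  y₀-∂y∈Γ = proj₂ (LinIndepOn⇒InΓ-mod-boundary X S indep y₀)

RowsFormBasis⇒RelativelyAcyclic : ∀ {d} (X : CWComplex d) S →
  RowsFormBasis (bd X d) S → RelativelyAcyclic X (∁ S)
RowsFormBasis⇒RelativelyAcyclic {d} X S (indep , spans) i i≤d with ℕP.m≤n⇒m<n∨m≡n i≤d
... | inj₂ refl = spans⇒InducedInjective-top X S spans , LinIndepOn⇒InducedSurjective-top X S indep
... | inj₁ i<d with ℕP.m≤n⇒m<n∨m≡n i<d
...   | inj₁ 1+i<d = InducedInjective-below X (∁ S) 1+i<d , InducedSurjective-below X (∁ S) i<d
...   | inj₂ refl  = LinIndepOn⇒InducedInjective-pred X S indep , InducedSurjective-below X (∁ S) i<d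

module _ {d} (X : CWComplex d) (G : Subset (size X d)) where

  private
    R : Fin (size X d) → Vecℚ (size X (suc d))
    R = rowsℚ (bd X d)

  InducedInjective-top⇒spans : InducedInjective X G d → ∀ σ → InSpanOf R (∁ G) (R σ)
  InducedInjective-top⇒spans inj σ = InSpan-restrictRows R (∁ G) (R σ)
    (annihilator-dual⇒InSpan _ (restrictRows (∁ G) R) (R σ) R·y≡0)
    where
    R·y≡0 : ∀ y → Annihilates y (restrictRows (∁ G) R) → R σ · y ≡ 0ℚ
    R·y≡0 y y⊥ = trans (sym (∂y′≡∂y σ)) (·-zeroʳ (R σ) y′ (to (InΓ-above X G (ℕP.n<1+n d)) y′∈Γ))
      where
      ∂y∈Γ : InΓ X G d (bdℚ X d y)
      ∂y∈Γ = from (InΓ-top X G) λ ρ ρ∉G →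
        trans (sumℚ-cong λ τ → cong (_* y τ) (sym (restrict-∈ (∁ G) (λ ρ → R ρ τ) (x∉p⇒x∈∁p ρ∉G))))
              (y⊥ ρ)
      boundary-in-Γ = inj (bdℚ X d y) ∂y∈Γ (IsCycle-bdℚ X d y) (y , λ _ → refl)
      y′ = proj₁ boundary-in-Γ
      y′∈Γ = proj₁ (proj₂ boundary-in-Γ)
      ∂y′≡∂y = proj₂ (proj₂ boundary-in-Γ)

  InducedSurjective-top⇒cycles-annihilated : InducedSurjective X G d →
    ∀ c → SupportedOn (∁ G) c → (∀ τ → lincomb c R τ ≡ 0ℚ) →
    ∀ z → IsCycle X d z → c · z ≡ 0ℚ
  InducedSurjective-top⇒cycles-annihilated surj c c∈∁G cR≡0 z z-cycle with surj z z-cycle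
  ... | z′ , z′∈Γ , _ , y , ∂y≡z-z′ = ·-≡0-split c z z′ c·∂y≡0 c·z′≡0
    where
    c·∂y≡0 : c · (z -ᵛ z′) ≡ 0ℚ
    c·∂y≡0 = begin
      c · (z -ᵛ z′)             ≡⟨ sumℚ-cong (λ σ → cong (c σ *_) (∂y≡z-z′ σ)) ⟨
      c · (λ σ → R σ · y)       ≡⟨ ·-lincomb c R y ⟩
      lincomb c R · y           ≡⟨ ·-zeroˡ (lincomb c R) y cR≡0 ⟩
      0ℚ                        ∎
    c·z′≡0 : c · z′ ≡ 0ℚ
    c·z′≡0 = ·-disjoint (∁ G) c z′ c∈∁G λ σ σ∈∁G → to (InΓ-top X G) z′∈Γ σ (x∈∁p⇒x∉p σ∈∁G)

RelativelyAcyclic⇒cycle-mod-Γ : ∀ {d} (X : CWComplex d) G → RelativelyAcyclic X G →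
  (x : Chain X d) → ∃ λ y → InΓ X G d y × IsCycle X d (x -ᵛ y)
RelativelyAcyclic⇒cycle-mod-Γ {zero} X G _ x = (λ _ → 0ℚ) , from (InΓ-top X G) (λ _ _ → refl) , tt
RelativelyAcyclic⇒cycle-mod-Γ {suc d} X G acyclic x with
  proj₁ (acyclic d (ℕP.n≤1+n d))
    (bdℚ X d x) (InΓ-below X G (ℕP.n<1+n d)) (IsCycle-bdℚ X d x) (x , λ _ → refl)
... | y , y∈Γ , ∂y≡∂x = y , y∈Γ , λ ρ →
  trans (·-distribʳ-sub (rowsℚ (bd X d) ρ) x y)
        (trans (cong (_-_ (bdℚ X d x ρ)) (∂y≡∂x ρ)) (ℚP.+-inverseʳ (bdℚ X d x ρ)))

RelativelyAcyclic⇒RowsFormBasis : ∀ {d} (X : CWComplex d) G →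
  RelativelyAcyclic X G → RowsFormBasis (bd X d) (∁ G)
RelativelyAcyclic⇒RowsFormBasis {d} X G acyclic = independent , InducedInjective-top⇒spans X G injective
  where
  injective = proj₁ (acyclic d ℕP.≤-refl)
  surjective = proj₂ (acyclic d ℕP.≤-refl)
  independent : LinIndepOn (rowsℚ (bd X d)) (∁ G)
  independent c c∈∁G cR≡0 σ _ with RelativelyAcyclic⇒cycle-mod-Γ X G acyclic (unit σ)
  ... | y , y∈Γ , σ-y-cycle = trans (sym (·-unitʳ c σ)) (·-≡0-split c (unit σ) y
    (InducedSurjective-top⇒cycles-annihilated X G surjective c c∈∁G cR≡0 (unit σ -ᵛ y) σ-y-cycle)
    (·-disjoint (∁ G) c y c∈∁G λ ρ ρ∈∁G → to (InΓ-top X G) y∈Γ ρ (x∈∁p⇒x∉p ρ∈∁G)))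

proposition4p1 : (d : ℕ) (X : CWComplex d) (r : ℕ) →
    HasRank (bd X d) r →
    (S : Subset (size X d)) → ∣ S ∣ ≡ r →
    RowsFormBasis (bd X d) S ⇔
      Σ (Subset (size X d)) (λ G → RelativelyAcyclic X G × S ≡ ∁ G)
proposition4p1 d X r _ S _ = mk⇔
  (λ basis → ∁ S , RowsFormBasis⇒RelativelyAcyclic X S basis , sym (∁-involutive S))
  (λ { (G , acyclic , refl) → RelativelyAcyclic⇒RowsFormBasis X G acyclic })
  where ∁-involutive = BooleanAlgebra.¬-involutive (∪-∩-booleanAlgebra (size X d))
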